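{- Let $n\ge2$. The free group $R_{\mathrm{Heis}_n}$ has a free generating set given by the union of the following sets: \begin{align*} A_1&=\{T^k\,(b^i a^n b^{ -i})\,T^{ -k}:\ 0\le i,k\le n-1\},\quad \#A_1=n^2,\\ A_2&=\{T^k\,(a^i b^n a^{ -i})\,T^{ -k}:\ 0\le i,k\le n-1\},\quad \#A_2=n^2,\\ A_3&=\{T^{n-1}\,(a^ib^j)T(a^ib^j)^{ -1}:\ 0\le i,j\le n-2\},\quad \#A_3=(n-1)^2,\\ A_4&=\{T^k\,(a^ib^j)T(a^ib^j)^{ -1}\,T^{ -(k+1)}:\ 0\le k,i,j\le n-2,\ (i,j)\ne(0,0)\},\quad \#A_4=(n-1)^3-(n-1), \end{align*} so that $R_{\mathrm{Heis}_n}$ has rank $n^3+1$.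
   Context: $F_2$ is the free group on $a,b$; $T=[a,b]=aba^{ -1}b^{ -1}$. $H_n$ is the group of $3\times3$ upper unitriangular matrices over $\mathbb{Z}/n\mathbb{Z}$, with $\alpha$ (resp. $\beta$) the matrix with $1$ in position $(1,2)$ (resp. $(2,3)$). $R_{\mathrm{Heis}_n}$ is the kernel of the surjection $F_2\to H_n$, $a\mapsto\alpha$, $b\mapsto\beta$ (the normal closure of $a^n$, $b^n$, $[a,T]$, $[b,T]$); it is a subgroup of index $n^3$ of $F_2$, hence free. -}

module Defs where

open import Data.Nat using (ℕ; zero; suc; _∸_)
open import Data.Fin using (Fin; toℕ) renaming (zero to fzero; suc to fsuc)
import Data.Fin.Properties as FinP
open import Data.Bool using (Bool; true; false; not; _∧_; _xor_; T; if_then_else_)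
open import Data.Bool.Properties using (T-irrelevant)
open import Data.Product using (Σ; _×_; _,_)
import Data.Product.Properties as ProdP
open import Data.Sum using (_⊎_; inj₁; inj₂)
import Data.Sum.Properties as SumP
open import Data.List using (List; []; _∷_; _++_; reverse; map; concatMap; replicate; concat; foldr)
open import Relation.Binary.Definitions using (DecidableEquality)
open import Relation.Nullary using (yes; no; does)
open import Relation.Binary.PropositionalEquality using (_≡_; refl)
open import Data.Integer using (ℤ; +_; -_) renaming (_+_ to _+ℤ_; _*_ to _*ℤ_)
open import Data.Integer.Divisibility using () renaming (_∣_ to _∣ℤ_)

-- Free groups: words in letters x^{±1}, modulo free reduction.
-- (x , false) stands for x, (x , true) for x⁻¹.

Letter : Set → Set
Letter X = X × Bool

Word : Set → Set
Word X = List (Letter X)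

invL : {X : Set} → Letter X → Letter X
invL (x , s) = x , not s

invW : {X : Set} → Word X → Word X
invW w = reverse (map invL w)

pow : {X : Set} → Word X → ℕ → Word X
pow w k = concat (replicate k w)

conj : {X : Set} → Word X → Word X → Word X
conj u v = u ++ v ++ invW u

module Reduction {X : Set} (_≟X_ : DecidableEquality X) where
  cancels : Letter X → Letter X → Bool
  cancels (x , s) (y , t) = does (x ≟X y) ∧ (s xor t)

  step : Letter X → Word X → Word X
  step x [] = x ∷ []
  step x (y ∷ ys) = if cancels x y then ys else x ∷ y ∷ ys

  -- free reduction normal form; two words represent the same element
  -- of the free group on X iff their normal forms are equal
  reduce : Word X → Word X
  reduce = foldr step []

eval : {I Y : Set} → (I → Word Y) → Word I → Word Y
eval g = concatMap λ { (i , false) → g i ; (i , true) → invW (g i) }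

F2gen : Set
F2gen = Fin 2

reduce₂ : Word F2gen → Word F2gen
reduce₂ = Reduction.reduce FinP._≟_

a b : Word F2gen
a = (fzero , false) ∷ []
b = (fsuc fzero , false) ∷ []

Tc : Word F2gen
Tc = a ++ b ++ invW a ++ invW b

-- The upper unitriangular matrix
--   [[1,x,z],[0,1,y],[0,0,1]]  is encoded as (x , y , z).
-- We compute the image of a word in the integral Heisenberg group and
-- then reduce mod n (reduction ℤ → ℤ/n is a ring hom, so this is the
-- image in H_n); the word is in the kernel iff x ≡ y ≡ z ≡ 0 mod n.

Heis : Set
Heis = ℤ × ℤ × ℤ

hmul : Heis → Heis → Heis
hmul (x , y , z) (x' , y' , z') = (x +ℤ x') , (y +ℤ y') , ((z +ℤ z') +ℤ (x *ℤ y'))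

hinv : Heis → Heis
hinv (x , y , z) = (- x) , (- y) , ((x *ℤ y) +ℤ (- z))

hgen : F2gen → Heis
hgen fzero = + 1 , + 0 , + 0
hgen (fsuc fzero) = + 0 , + 1 , + 0

hletter : Letter F2gen → Heis
hletter (g , false) = hgen g
hletter (g , true) = hinv (hgen g)

hword : Word F2gen → Heis
hword = foldr (λ l h → hmul (hletter l) h) (+ 0 , + 0 , + 0)

InR : ℕ → Word F2gen → Set
InR n w with hword w
... | (x , y , z) = (+ n ∣ℤ x) × (+ n ∣ℤ y) × (+ n ∣ℤ z)

isZ : {m : ℕ} → Fin m → Bool
isZ fzero = true
isZ (fsuc _) = false

NZPair : ℕ → Set
NZPair m = Σ (Fin m × Fin m) λ { (i , j) → T (not (isZ i ∧ isZ j)) }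

Idx : ℕ → Set
Idx n = (Fin n × Fin n)                 -- A₁ : (i , k)
      ⊎ ((Fin n × Fin n)                -- A₂ : (i , k)
      ⊎ ((Fin (n ∸ 1) × Fin (n ∸ 1))    -- A₃ : (i , j), 0 ≤ i,j ≤ n-2
      ⊎ (Fin (n ∸ 1) × NZPair (n ∸ 1)))) -- A₄ : (k , (i , j))

_≟Idx_ : {n : ℕ} → DecidableEquality (Idx n)
_≟Idx_ = SumP.≡-dec pairDec (SumP.≡-dec pairDec (SumP.≡-dec pairDec
           (ProdP.≡-dec FinP._≟_ (ProdP.≡-dec pairDec λ p q → yes (T-irrelevant p q)))))
  where
  pairDec : {m k : ℕ} → DecidableEquality (Fin m × Fin k)
  pairDec = ProdP.≡-dec FinP._≟_ FinP._≟_

reduceIdx : {n : ℕ} → Word (Idx n) → Word (Idx n)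
reduceIdx = Reduction.reduce _≟Idx_

gens : (n : ℕ) → Idx n → Word F2gen
gens n (inj₁ (i , k)) = conj (pow Tc (toℕ k)) (conj (pow b (toℕ i)) (pow a n))
gens n (inj₂ (inj₁ (i , k))) = conj (pow Tc (toℕ k)) (conj (pow a (toℕ i)) (pow b n))
gens n (inj₂ (inj₂ (inj₁ (i , j)))) =
  pow Tc (n ∸ 1) ++ conj (pow a (toℕ i) ++ pow b (toℕ j)) Tc
gens n (inj₂ (inj₂ (inj₂ (k , ((i , j) , _))))) =
  pow Tc (toℕ k) ++ conj (pow a (toℕ i) ++ pow b (toℕ j)) Tc ++ invW (pow Tc (suc (toℕ k)))

IsFreeBasisOfR : (n : ℕ) → {I : Set} → (reduceI : Word I → Word I) → (I → Word F2gen) → Set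
IsFreeBasisOfR n {I} reduceI g =
    (∀ (w : Word I) → InR n (eval g w))
  × (∀ (x : Word F2gen) → InR n x → Σ (Word I) λ w → reduce₂ (eval g w) ≡ reduce₂ x)
  × (∀ (u v : Word I) → reduce₂ (eval g u) ≡ reduce₂ (eval g v) → reduceI u ≡ reduceI v)

{-# OPTIONS --safe #-}
module Submission where

-- Reidemeister–Schreier.  F₂/R ≅ H_n is the set of n³ vertices (x , y , k), the cosets of T^k a^x b^y,
-- and reading a word letter by letter walks through this Schreier graph.  Each edge is rewritten as a
-- word in the A's that evaluates to its Schreier generator tr v · l · tr (v l)⁻¹: the T-loops give A₃
-- and A₄, the edges leaving the last column or row give A₁ and A₂, and the other a-edges are products
-- of T-loops.  So the rewriting τ w of a loop w at the base vertex evaluates back to w, which gives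
-- surjectivity onto R, and every A_i is rewritten to itself, so τ is a left inverse of evaluation, which
-- gives injectivity.  A word lies in R iff it is a loop, by computing in Heisenberg coordinates mod n.

open import Defs
open import Data.Nat as ℕ using (ℕ; zero; suc; _≤_; _^_)
import Data.Nat.Properties as ℕP
open import Data.Nat.GeneralisedArithmetic using (iterate; fold; iterate-is-fold; fold-+)
open import Data.Fin using (Fin; toℕ; inject₁; fromℕ; fromℕ<) renaming (zero to fzero; suc to fsuc)
import Data.Fin.Properties as FinP
open import Data.Fin.Induction using (<-weakInduction)
open import Data.Fin.Patterns using (0F; 1F)
open import Data.Bool using (true; false; not; _xor_)
open import Data.Product using (Σ; _×_; _,_)
open import Data.Sum using (inj₁; inj₂)
open import Data.Unit using (⊤)
open import Data.List using ([]; _∷_; _++_; reverse; map; foldr)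
import Data.List.Properties as List
open import Data.Vec using (Vec; lookup)
open import Function.Bundles using (_↔_)
open import Relation.Binary.Bundles using (Setoid)
open import Relation.Binary.Definitions using (DecidableEquality)
open import Relation.Nullary using (yes; no)
open import Relation.Nullary.Decidable using (dec-true)
open import Relation.Binary.PropositionalEquality
import Relation.Binary.Reasoning.Setoid as SetoidReasoning

private
  variable
    X : Set

invL-involutive : (l : Letter X) → invL (invL l) ≡ l
invL-involutive (x , false) = refl
invL-involutive (x , true) = refl

invW-∷ : (l : Letter X) (u : Word X) → invW (l ∷ u) ≡ invW u ++ invL l ∷ []
invW-∷ l u = List.unfold-reverse (invL l) (map invL u)

invW-++ : (u v : Word X) → invW (u ++ v) ≡ invW v ++ invW u
invW-++ u v = trans (cong reverse (List.map-++ invL u v)) (List.reverse-++ (map invL u) (map invL v))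

invW-involutive : (u : Word X) → invW (invW u) ≡ u
invW-involutive [] = refl
invW-involutive (l ∷ u) = begin
  invW (invW (l ∷ u))             ≡⟨ cong invW (invW-∷ l u) ⟩
  invW (invW u ++ invL l ∷ [])    ≡⟨ invW-++ (invW u) (invL l ∷ []) ⟩
  invL (invL l) ∷ invW (invW u)   ≡⟨ cong₂ _∷_ (invL-involutive l) (invW-involutive u) ⟩
  l ∷ u                           ∎
  where open ≡-Reasoning

pow-sucʳ : (w : Word X) (k : ℕ) → pow w (suc k) ≡ pow w k ++ w
pow-sucʳ w zero = List.++-identityʳ w
pow-sucʳ w (suc k) = trans (cong (w ++_) (pow-sucʳ w k)) (sym (List.++-assoc w (pow w k) w))

module _ {I Y : Set} (g : I → Word Y) where

  eval-++ : (u v : Word I) → eval g (u ++ v) ≡ eval g u ++ eval g v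
  eval-++ [] v = refl
  eval-++ ((i , false) ∷ u) v = trans (cong (g i ++_) (eval-++ u v)) (sym (List.++-assoc (g i) _ _))
  eval-++ ((i , true) ∷ u) v = trans (cong (invW (g i) ++_) (eval-++ u v)) (sym (List.++-assoc (invW (g i)) _ _))

  eval-invL : (l : Letter I) → eval g (invL l ∷ []) ≡ invW (eval g (l ∷ []))
  eval-invL (i , false) = trans (List.++-identityʳ (invW (g i))) (cong invW (sym (List.++-identityʳ (g i))))
  eval-invL (i , true) = begin
    g i ++ []               ≡⟨ List.++-identityʳ (g i) ⟩
    g i                     ≡⟨ invW-involutive (g i) ⟨
    invW (invW (g i))       ≡⟨ cong invW (List.++-identityʳ (invW (g i))) ⟨
    invW (invW (g i) ++ []) ∎
    where open ≡-Reasoning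

  eval-invW : (u : Word I) → eval g (invW u) ≡ invW (eval g u)
  eval-invW [] = refl
  eval-invW (l ∷ u) = begin
    eval g (invW (l ∷ u))                          ≡⟨ cong (eval g) (invW-∷ l u) ⟩
    eval g (invW u ++ invL l ∷ [])                 ≡⟨ eval-++ (invW u) (invL l ∷ []) ⟩
    eval g (invW u) ++ eval g (invL l ∷ [])        ≡⟨ cong₂ _++_ (eval-invW u) (eval-invL l) ⟩
    invW (eval g u) ++ invW (eval g (l ∷ []))      ≡⟨ invW-++ (eval g (l ∷ [])) (eval g u) ⟨
    invW (eval g (l ∷ []) ++ eval g u)             ≡⟨ cong invW (eval-++ (l ∷ []) u) ⟨
    invW (eval g (l ∷ u))                          ∎
    where open ≡-Reasoning

module FreeGroup {X : Set} (_≟_ : DecidableEquality X) where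

  open Reduction _≟_ public

  cancels-invL : ∀ l → cancels l (invL l) ≡ true
  cancels-invL (x , s) rewrite dec-true (x ≟ x) refl = xor-not s
    where
    xor-not : ∀ s → (s xor not s) ≡ true
    xor-not false = refl
    xor-not true = refl

  cancels⇒invL : ∀ l l′ → cancels l l′ ≡ true → l′ ≡ invL l
  cancels⇒invL (x , s) (y , t) eq with x ≟ y
  cancels⇒invL (x , false) (.x , true) eq | yes refl = refl
  cancels⇒invL (x , true) (.x , false) eq | yes refl = refl
  cancels⇒invL (x , false) (.x , false) () | yes refl
  cancels⇒invL (x , true) (.x , true) () | yes refl
  cancels⇒invL (x , s) (y , t) () | no _

  Reduced : Word X → Set
  Reduced [] = ⊤
  Reduced (l ∷ []) = ⊤
  Reduced (l ∷ l′ ∷ w) = (cancels l l′ ≡ false) × Reduced (l′ ∷ w)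

  Reduced-tail : ∀ l w → Reduced (l ∷ w) → Reduced w
  Reduced-tail l [] r = _
  Reduced-tail l (l′ ∷ w) (_ , r) = r

  step-Reduced : ∀ l w → Reduced w → Reduced (step l w)
  step-Reduced l [] r = _
  step-Reduced l (l′ ∷ w) r with cancels l l′ in eq
  ... | true = Reduced-tail l′ w r
  ... | false = eq , r

  foldr-step-Reduced : ∀ u w → Reduced w → Reduced (foldr step w u)
  foldr-step-Reduced [] w r = r
  foldr-step-Reduced (l ∷ u) w r = step-Reduced l _ (foldr-step-Reduced u w r)

  reduce-Reduced : ∀ w → Reduced (reduce w)
  reduce-Reduced w = foldr-step-Reduced w [] _

  step-Reduced-∷ : ∀ l w → Reduced (l ∷ w) → step l w ≡ l ∷ w
  step-Reduced-∷ l [] r = refl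
  step-Reduced-∷ l (l′ ∷ w) (nc , r) rewrite nc = refl

  step-invL : ∀ l w → Reduced w → step l (step (invL l) w) ≡ w
  step-invL l [] r rewrite cancels-invL l = refl
  step-invL l (l′ ∷ w) r with cancels (invL l) l′ in eq
  ... | false rewrite cancels-invL l = refl
  ... | true = trans (step-Reduced-∷ l w (subst (λ l″ → Reduced (l″ ∷ w)) l′≡l r)) (cong (_∷ w) (sym l′≡l))
    where
    l′≡l : l′ ≡ l
    l′≡l = trans (cancels⇒invL (invL l) l′ eq) (invL-involutive l)

  foldr-step-step : ∀ l u w → Reduced u → Reduced w → foldr step w (step l u) ≡ step l (foldr step w u)
  foldr-step-step l [] w _ _ = refl
  foldr-step-step l (l′ ∷ u) w ru rw with cancels l l′ in eq
  ... | false = refl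
  ... | true rewrite cancels⇒invL l l′ eq = sym (step-invL l (foldr step w u) (foldr-step-Reduced u w rw))

  foldr-step-reduce : ∀ u w → Reduced w → foldr step w (reduce u) ≡ foldr step w u
  foldr-step-reduce [] w r = refl
  foldr-step-reduce (l ∷ u) w r =
    trans (foldr-step-step l (reduce u) w (reduce-Reduced u) r) (cong (step l) (foldr-step-reduce u w r))

  reduce-++ : ∀ u v → reduce (u ++ v) ≡ foldr step (reduce v) (reduce u)
  reduce-++ u v = trans (List.foldr-++ step [] u v) (sym (foldr-step-reduce u (reduce v) (reduce-Reduced v)))

  infix 4 _~_
  record _~_ (u v : Word X) : Set where
    constructor mk~
    field reduce-≡ : reduce u ≡ reduce v
  open _~_ public

  ~-refl : ∀ {u} → u ~ u
  ~-refl = mk~ refl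

  ~-reflexive : ∀ {u v} → u ≡ v → u ~ v
  ~-reflexive refl = ~-refl

  ~-sym : ∀ {u v} → u ~ v → v ~ u
  ~-sym (mk~ p) = mk~ (sym p)

  ~-trans : ∀ {u v w} → u ~ v → v ~ w → u ~ w
  ~-trans (mk~ p) (mk~ q) = mk~ (trans p q)

  ~-setoid : Setoid _ _
  ~-setoid = record
    { Carrier = Word X ; _≈_ = _~_
    ; isEquivalence = record { refl = ~-refl ; sym = ~-sym ; trans = ~-trans } }

  module ~-Reasoning = SetoidReasoning ~-setoid

  ++-cong : ∀ {u u′ v v′} → u ~ u′ → v ~ v′ → u ++ v ~ u′ ++ v′
  ++-cong {u} {u′} {v} {v′} (mk~ p) (mk~ q) =
    mk~ (trans (reduce-++ u v) (trans (cong₂ (foldr step) q p) (sym (reduce-++ u′ v′))))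

  ++-congˡ : ∀ {u u′} v → u ~ u′ → u ++ v ~ u′ ++ v
  ++-congˡ v p = ++-cong p ~-refl

  ++-congʳ : ∀ u {v v′} → v ~ v′ → u ++ v ~ u ++ v′
  ++-congʳ u q = ++-cong {u} ~-refl q

  invL-cancel : ∀ l v → l ∷ invL l ∷ v ~ v
  invL-cancel l v = mk~ (step-invL l (reduce v) (reduce-Reduced v))

  ++-inverseʳ : ∀ u → u ++ invW u ~ []
  ++-inverseʳ [] = ~-refl
  ++-inverseʳ (l ∷ u) = begin
    l ∷ u ++ invW (l ∷ u)                   ≡⟨ cong (λ w → l ∷ u ++ w) (invW-∷ l u) ⟩
    l ∷ u ++ invW u ++ invL l ∷ []          ≡⟨ cong (l ∷_) (List.++-assoc u (invW u) _) ⟨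
    l ∷ (u ++ invW u) ++ invL l ∷ []        ≈⟨ ++-congʳ (l ∷ []) (++-congˡ (invL l ∷ []) (++-inverseʳ u)) ⟩
    l ∷ invL l ∷ []                         ≈⟨ invL-cancel l [] ⟩
    []                                      ∎
    where open ~-Reasoning

  ++-inverseˡ : ∀ u → invW u ++ u ~ []
  ++-inverseˡ u = ~-trans (~-reflexive (cong (invW u ++_) (sym (invW-involutive u)))) (++-inverseʳ (invW u))

  invW-cong : ∀ {u v} → u ~ v → invW u ~ invW v
  invW-cong {u} {v} u~v = begin
    invW u                    ≡⟨ List.++-identityʳ (invW u) ⟨
    invW u ++ []              ≈⟨ ++-congʳ (invW u) (++-inverseʳ v) ⟨
    invW u ++ v ++ invW v     ≈⟨ ++-congʳ (invW u) (++-congˡ (invW v) u~v) ⟨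
    invW u ++ u ++ invW v     ≡⟨ List.++-assoc (invW u) u (invW v) ⟨
    (invW u ++ u) ++ invW v   ≈⟨ ++-congˡ (invW v) (++-inverseˡ u) ⟩
    invW v                    ∎
    where open ~-Reasoning

  cancel-inverseʳ : ∀ u w → u ++ invW u ++ w ~ w
  cancel-inverseʳ u w = ~-trans (~-reflexive (sym (List.++-assoc u (invW u) w))) (++-congˡ w (++-inverseʳ u))

module _ {I X : Set} (_≟ᴵ_ : DecidableEquality I) (_≟_ : DecidableEquality X) (g : I → Word X) where

  private module Fᴵ = FreeGroup _≟ᴵ_
  open FreeGroup _≟_

  eval-step : ∀ l w → eval g (Fᴵ.step l w) ~ eval g (l ∷ w)
  eval-step l [] = ~-refl
  eval-step l (l′ ∷ w) with Fᴵ.cancels l l′ in eq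
  ... | false = ~-refl
  ... | true rewrite Fᴵ.cancels⇒invL l l′ eq = ~-sym (begin
    eval g (l ∷ invL l ∷ w)                    ≡⟨ eval-++ g (l ∷ []) (invL l ∷ w) ⟩
    L ++ eval g (invL l ∷ w)                   ≡⟨ cong (L ++_) (eval-++ g (invL l ∷ []) w) ⟩
    L ++ eval g (invL l ∷ []) ++ eval g w      ≡⟨ cong (λ u → L ++ u ++ eval g w) (eval-invL g l) ⟩
    L ++ invW L ++ eval g w                    ≈⟨ cancel-inverseʳ L (eval g w) ⟩
    eval g w                                   ∎)
    where
    open ~-Reasoning
    L = eval g (l ∷ [])

  eval-reduce : ∀ w → eval g (Fᴵ.reduce w) ~ eval g w
  eval-reduce [] = ~-refl
  eval-reduce (l ∷ w) = begin
    eval g (Fᴵ.step l (Fᴵ.reduce w))          ≈⟨ eval-step l (Fᴵ.reduce w) ⟩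
    eval g (l ∷ Fᴵ.reduce w)                  ≡⟨ eval-++ g (l ∷ []) (Fᴵ.reduce w) ⟩
    eval g (l ∷ []) ++ eval g (Fᴵ.reduce w)   ≈⟨ ++-congʳ (eval g (l ∷ [])) (eval-reduce w) ⟩
    eval g (l ∷ []) ++ eval g w               ≡⟨ eval-++ g (l ∷ []) w ⟨
    eval g (l ∷ w)                            ∎
    where open ~-Reasoning

-- Group expressions in k variables; Solver.solve proves an identity between two of them by
-- computing the free reductions of the corresponding words over Fin k.
infixr 5 _∙_
infix 8 _⁻¹

data Expr (k : ℕ) : Set where
  var : Fin k → Expr k
  ε : Expr k
  _∙_ : Expr k → Expr k → Expr k
  _⁻¹ : Expr k → Expr k

module Solver {X : Set} (_≟_ : DecidableEquality X) where

  open FreeGroup _≟_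

  ⟦_⟧ : ∀ {k} → Expr k → Vec (Word X) k → Word X
  ⟦ var i ⟧ ρ = lookup ρ i
  ⟦ ε ⟧ ρ = []
  ⟦ e ∙ f ⟧ ρ = ⟦ e ⟧ ρ ++ ⟦ f ⟧ ρ
  ⟦ e ⁻¹ ⟧ ρ = invW (⟦ e ⟧ ρ)

  toWord : ∀ {k} → Expr k → Word (Fin k)
  toWord (var i) = (i , false) ∷ []
  toWord ε = []
  toWord (e ∙ f) = toWord e ++ toWord f
  toWord (e ⁻¹) = invW (toWord e)

  ⟦_⇓⟧ : ∀ {k} → Expr k → Vec (Word X) k → Word X
  ⟦ e ⇓⟧ ρ = eval (lookup ρ) (Reduction.reduce FinP._≟_ (toWord e))

  ⟦⟧≡eval-toWord : ∀ {k} (e : Expr k) ρ → ⟦ e ⟧ ρ ≡ eval (lookup ρ) (toWord e)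
  ⟦⟧≡eval-toWord (var i) ρ = sym (List.++-identityʳ (lookup ρ i))
  ⟦⟧≡eval-toWord ε ρ = refl
  ⟦⟧≡eval-toWord (e ∙ f) ρ =
    trans (cong₂ _++_ (⟦⟧≡eval-toWord e ρ) (⟦⟧≡eval-toWord f ρ)) (sym (eval-++ (lookup ρ) (toWord e) (toWord f)))
  ⟦⟧≡eval-toWord (e ⁻¹) ρ = trans (cong invW (⟦⟧≡eval-toWord e ρ)) (sym (eval-invW (lookup ρ) (toWord e)))

  ⟦⇓⟧-correct : ∀ {k} (e : Expr k) ρ → ⟦ e ⇓⟧ ρ ~ ⟦ e ⟧ ρ
  ⟦⇓⟧-correct e ρ = ~-trans (eval-reduce FinP._≟_ _≟_ (lookup ρ) (toWord e)) (~-reflexive (sym (⟦⟧≡eval-toWord e ρ)))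

  open import Relation.Binary.Reflection ~-setoid var ⟦_⟧ ⟦_⇓⟧ ⟦⇓⟧-correct public using (solve; _⊜_)

module SchreierRewriting {X V : Set} (act : V → Letter X → V) (act-invL : ∀ v l → act (act v l) (invL l) ≡ v) where

  endpoint : V → Word X → V
  endpoint v [] = v
  endpoint v (l ∷ w) = endpoint (act v l) w

  endpoint-++ : ∀ v u w → endpoint v (u ++ w) ≡ endpoint (endpoint v u) w
  endpoint-++ v [] w = refl
  endpoint-++ v (l ∷ u) w = endpoint-++ (act v l) u w

  endpoint-invW : ∀ v u → endpoint (endpoint v u) (invW u) ≡ v
  endpoint-invW v [] = refl
  endpoint-invW v (l ∷ u) = begin
    endpoint (endpoint (act v l) u) (invW (l ∷ u))
      ≡⟨ cong (endpoint (endpoint (act v l) u)) (invW-∷ l u) ⟩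
    endpoint (endpoint (act v l) u) (invW u ++ invL l ∷ [])
      ≡⟨ endpoint-++ (endpoint (act v l) u) (invW u) (invL l ∷ []) ⟩
    act (endpoint (endpoint (act v l) u) (invW u)) (invL l)
      ≡⟨ cong (λ v′ → act v′ (invL l)) (endpoint-invW (act v l) u) ⟩
    act (act v l) (invL l)
      ≡⟨ act-invL v l ⟩
    v ∎
    where open ≡-Reasoning

  module Rewriting {I : Set} (_≟X_ : DecidableEquality X) (_≟I_ : DecidableEquality I) (γ⁺ : V → X → Word I) where

    private
      module Fˣ = FreeGroup _≟X_
      module Fᴵ = FreeGroup _≟I_
    open Fᴵ using (_~_; ~-refl; ~-sym; ~-trans; ~-reflexive; ++-cong; ++-congʳ; ++-congˡ)

    γ : V → Letter X → Word I
    γ v (x , false) = γ⁺ v x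
    γ v (x , true) = invW (γ⁺ (act v (x , true)) x)

    τ : V → Word X → Word I
    τ v [] = []
    τ v (l ∷ w) = γ v l ++ τ (act v l) w

    γ-invL : ∀ v l → γ (act v l) (invL l) ≡ invW (γ v l)
    γ-invL v (x , false) = cong (λ v′ → invW (γ⁺ v′ x)) (act-invL v (x , false))
    γ-invL v (x , true) = sym (invW-involutive _)

    τ-++ : ∀ v u w → τ v (u ++ w) ≡ τ v u ++ τ (endpoint v u) w
    τ-++ v [] w = refl
    τ-++ v (l ∷ u) w = trans (cong (γ v l ++_) (τ-++ (act v l) u w)) (sym (List.++-assoc (γ v l) _ _))

    τ-invW : ∀ v u → τ (endpoint v u) (invW u) ≡ invW (τ v u)
    τ-invW v [] = refl
    τ-invW v (l ∷ u) = begin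
      τ v′ (invW (l ∷ u))                                     ≡⟨ cong (τ v′) (invW-∷ l u) ⟩
      τ v′ (invW u ++ invL l ∷ [])                            ≡⟨ τ-++ v′ (invW u) (invL l ∷ []) ⟩
      τ v′ (invW u) ++ γ (endpoint v′ (invW u)) (invL l) ++ []
        ≡⟨ cong₂ (λ w v″ → w ++ γ v″ (invL l) ++ []) (τ-invW (act v l) u) (endpoint-invW (act v l) u) ⟩
      invW (τ (act v l) u) ++ γ (act v l) (invL l) ++ []
        ≡⟨ cong (invW (τ (act v l) u) ++_) (List.++-identityʳ _) ⟩
      invW (τ (act v l) u) ++ γ (act v l) (invL l)            ≡⟨ cong (invW (τ (act v l) u) ++_) (γ-invL v l) ⟩
      invW (τ (act v l) u) ++ invW (γ v l)                    ≡⟨ invW-++ (γ v l) (τ (act v l) u) ⟨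
      invW (γ v l ++ τ (act v l) u)                           ∎
      where
      open ≡-Reasoning
      v′ = endpoint (act v l) u

    τ-step : ∀ v l w → τ v (Fˣ.step l w) ~ τ v (l ∷ w)
    τ-step v l [] = ~-refl
    τ-step v l (l′ ∷ w) with Fˣ.cancels l l′ in eq
    ... | false = ~-refl
    ... | true rewrite Fˣ.cancels⇒invL l l′ eq = ~-sym (begin
      γ v l ++ γ (act v l) (invL l) ++ τ (act (act v l) (invL l)) w
        ≡⟨ cong₂ (λ u v′ → γ v l ++ u ++ τ v′ w) (γ-invL v l) (act-invL v l) ⟩
      γ v l ++ invW (γ v l) ++ τ v w
        ≈⟨ Fᴵ.cancel-inverseʳ (γ v l) (τ v w) ⟩
      τ v w ∎)
      where open Fᴵ.~-Reasoning

    τ-reduce : ∀ v w → τ v (Fˣ.reduce w) ~ τ v w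
    τ-reduce v [] = ~-refl
    τ-reduce v (l ∷ w) = ~-trans (τ-step v l (Fˣ.reduce w)) (++-congʳ (γ v l) (τ-reduce (act v l) w))

    record Rewrites (v : V) (u : Word X) (w : Word I) (v′ : V) : Set where
      constructor rewrites
      field
        τ~ : τ v u ~ w
        endpoint≡ : endpoint v u ≡ v′
    open Rewrites public

    Rewrites-[] : ∀ v → Rewrites v [] [] v
    Rewrites-[] v = rewrites ~-refl refl

    Rewrites-step : ∀ {v l w v′} → γ v l ≡ w → act v l ≡ v′ → Rewrites v (l ∷ []) w v′
    Rewrites-step {v} {l} refl refl = rewrites (~-reflexive (List.++-identityʳ (γ v l))) refl

    Rewrites-++ : ∀ {v u w v′ u′ w′ v″} → Rewrites v u w v′ → Rewrites v′ u′ w′ v″ →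
                  Rewrites v (u ++ u′) (w ++ w′) v″
    Rewrites-++ {v} {u} {u′ = u′} (rewrites p refl) (rewrites q refl) =
      rewrites (~-trans (~-reflexive (τ-++ v u u′)) (++-cong p q)) (endpoint-++ v u u′)

    Rewrites-invW : ∀ {v u w v′} → Rewrites v u w v′ → Rewrites v′ (invW u) (invW w) v
    Rewrites-invW {v} {u} (rewrites p refl) =
      rewrites (~-trans (~-reflexive (τ-invW v u)) (Fᴵ.invW-cong p)) (endpoint-invW v u)

    Rewrites-resp-~ : ∀ {v u w w′ v′} → w ~ w′ → Rewrites v u w v′ → Rewrites v u w′ v′
    Rewrites-resp-~ w~w′ (rewrites p e) = rewrites (~-trans p w~w′) e

    Rewrites-conj : ∀ {v u v′ c w} → Rewrites v u [] v′ → Rewrites v′ c w v′ → Rewrites v (conj u c) w v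
    Rewrites-conj p q = Rewrites-resp-~ (~-reflexive (List.++-identityʳ _)) (Rewrites-++ p (Rewrites-++ q (Rewrites-invW p)))

    power-walk : ∀ {k} (u : Word X) (p : Fin (suc k) → V) →
                 (∀ i → Rewrites (p (inject₁ i)) u [] (p (fsuc i))) →
                 ∀ x → Rewrites (p fzero) (pow u (toℕ x)) [] (p x)
    power-walk u p step = <-weakInduction (λ x → Rewrites (p fzero) (pow u (toℕ x)) [] (p x)) (Rewrites-[] (p fzero))
      λ i walk → subst (λ w → Rewrites (p fzero) w [] (p (fsuc i))) (sym (pow-sucʳ u (toℕ i)))
                   (Rewrites-++ (subst (λ t → Rewrites (p fzero) (pow u t) [] (p (inject₁ i))) (FinP.toℕ-inject₁ i) walk)
                                (step i))

    module _ (g : I → Word X) (tr : V → Word X)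
             (γ⁺-eval : ∀ v x → eval g (γ⁺ v x) Fˣ.~ tr v ++ (x , false) ∷ invW (tr (act v (x , false)))) where

      open Solver _≟X_

      γ-eval : ∀ v l → eval g (γ v l) Fˣ.~ tr v ++ l ∷ invW (tr (act v l))
      γ-eval v (x , false) = γ⁺-eval v x
      γ-eval v (x , true) = begin
        eval g (invW (γ⁺ v′ x))                                      ≡⟨ eval-invW g (γ⁺ v′ x) ⟩
        invW (eval g (γ⁺ v′ x))                                      ≈⟨ Fˣ.invW-cong (γ⁺-eval v′ x) ⟩
        invW (tr v′ ++ (x , false) ∷ invW (tr (act v′ (x , false))))
          ≡⟨ cong (λ v″ → invW (tr v′ ++ (x , false) ∷ invW (tr v″))) (act-invL v (x , true)) ⟩
        invW (tr v′ ++ (x , false) ∷ invW (tr v))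
          ≈⟨ solve 3 (λ A l B → (A ∙ l ∙ B ⁻¹) ⁻¹ ⊜ B ∙ l ⁻¹ ∙ A ⁻¹) Fˣ.~-refl
                   (tr v′) ((x , false) ∷ []) (tr v) ⟩
        tr v ++ (x , true) ∷ invW (tr v′)                            ∎
        where
        open Fˣ.~-Reasoning
        v′ = act v (x , true)

      τ-eval : ∀ v w → eval g (τ v w) Fˣ.~ tr v ++ w ++ invW (tr (endpoint v w))
      τ-eval v [] = solve 1 (λ B → ε ⊜ B ∙ ε ∙ B ⁻¹) Fˣ.~-refl (tr v)
      τ-eval v (l ∷ w) = begin
        eval g (γ v l ++ τ v′ w)                                   ≡⟨ eval-++ g (γ v l) (τ v′ w) ⟩
        eval g (γ v l) ++ eval g (τ v′ w)                          ≈⟨ Fˣ.++-cong (γ-eval v l) (τ-eval v′ w) ⟩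
        (tr v ++ l ∷ invW (tr v′)) ++ tr v′ ++ w ++ invW (tr e)
          ≈⟨ solve 5 (λ B L C W E → (B ∙ L ∙ C ⁻¹) ∙ C ∙ W ∙ E ⁻¹ ⊜ B ∙ L ∙ W ∙ E ⁻¹) Fˣ.~-refl
                   (tr v) (l ∷ []) (tr v′) w (tr e) ⟩
        tr v ++ l ∷ w ++ invW (tr e)                               ∎
        where
        open Fˣ.~-Reasoning
        v′ = act v l
        e = endpoint v′ w

    module _ (g : I → Word X) (v₀ : V) (gens-rewrite : ∀ i → Rewrites v₀ (g i) ((i , false) ∷ []) v₀) where

      eval-rewrites : ∀ u → Rewrites v₀ (eval g u) u v₀
      eval-rewrites [] = Rewrites-[] v₀
      eval-rewrites ((i , false) ∷ u) = Rewrites-++ (gens-rewrite i) (eval-rewrites u)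
      eval-rewrites ((i , true) ∷ u) = Rewrites-++ (Rewrites-invW (gens-rewrite i)) (eval-rewrites u)

      eval-injective : ∀ u u′ → eval g u Fˣ.~ eval g u′ → u ~ u′
      eval-injective u u′ (Fˣ.mk~ e) = begin
        u                              ≈⟨ τ~ (eval-rewrites u) ⟨
        τ v₀ (eval g u)                ≈⟨ τ-reduce v₀ (eval g u) ⟨
        τ v₀ (Fˣ.reduce (eval g u))    ≡⟨ cong (τ v₀) e ⟩
        τ v₀ (Fˣ.reduce (eval g u′))   ≈⟨ τ-reduce v₀ (eval g u′) ⟩
        τ v₀ (eval g u′)               ≈⟨ τ~ (eval-rewrites u′) ⟩
        u′                             ∎
        where open Fᴵ.~-Reasoning

module ModularArithmetic where

  open import Data.Nat.DivMod using (m<n⇒m%n≡m)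
  open import Data.Nat.Divisibility using (n∣m⇒m%n≡0)
  open import Data.Integer using (ℤ; +_; -_; _+_; _-_; _*_; ∣_∣)
  import Data.Integer.Properties as ℤP
  open import Data.Integer.Divisibility.Signed
    using (_∣_; divides; ∣m∣n⇒∣m+n; ∣m⇒∣-m; ∣m⇒∣m*n; ∣n⇒∣m*n; ∣⇒∣ᵤ; ∣ᵤ⇒∣)
  import Data.Integer.Divisibility as Unsigned
  open import Data.Integer.Tactic.RingSolver using (solve-∀)
  open import Function.Base using (_$_)

  infix 4 _≡_[mod_]
  record _≡_[mod_] (a b : ℤ) (n : ℕ) : Set where
    constructor mod-by
    field n∣a-b : + n ∣ a - b

  module _ {n : ℕ} where

    ≡-mod-reflexive : ∀ {a b} → a ≡ b → a ≡ b [mod n ]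
    ≡-mod-reflexive {a} refl = mod-by $ divides (+ 0) (trans (ℤP.+-inverseʳ a) (sym (ℤP.*-zeroˡ (+ n))))

    ≡-mod-refl : ∀ {a} → a ≡ a [mod n ]
    ≡-mod-refl = ≡-mod-reflexive refl

    ≡-mod-sym : ∀ {a b} → a ≡ b [mod n ] → b ≡ a [mod n ]
    ≡-mod-sym {a} {b} (mod-by a≡b) = mod-by $ subst (+ n ∣_) (lemma a b) (∣m⇒∣-m a≡b)
      where
      lemma : ∀ a b → - (a - b) ≡ b - a
      lemma = solve-∀

    ≡-mod-trans : ∀ {a b c} → a ≡ b [mod n ] → b ≡ c [mod n ] → a ≡ c [mod n ]
    ≡-mod-trans {a} {b} {c} (mod-by a≡b) (mod-by b≡c) = mod-by $ subst (+ n ∣_) (lemma a b c) (∣m∣n⇒∣m+n a≡b b≡c)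
      where
      lemma : ∀ a b c → (a - b) + (b - c) ≡ a - c
      lemma = solve-∀

    ≡-mod-setoid : Setoid _ _
    ≡-mod-setoid = record
      { Carrier = ℤ ; _≈_ = _≡_[mod n ]
      ; isEquivalence = record { refl = ≡-mod-refl ; sym = ≡-mod-sym ; trans = ≡-mod-trans } }

    module ≡-mod-Reasoning = SetoidReasoning ≡-mod-setoid

    +-cong-mod : ∀ {a b c d} → a ≡ b [mod n ] → c ≡ d [mod n ] → a + c ≡ b + d [mod n ]
    +-cong-mod {a} {b} {c} {d} (mod-by a≡b) (mod-by c≡d) = mod-by $ subst (+ n ∣_) (lemma a b c d) (∣m∣n⇒∣m+n a≡b c≡d)
      where
      lemma : ∀ a b c d → (a - b) + (c - d) ≡ (a + c) - (b + d)
      lemma = solve-∀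

    *-cong-mod : ∀ {a b c d} → a ≡ b [mod n ] → c ≡ d [mod n ] → a * c ≡ b * d [mod n ]
    *-cong-mod {a} {b} {c} {d} (mod-by a≡b) (mod-by c≡d) =
      mod-by $ subst (+ n ∣_) (lemma a b c d) (∣m∣n⇒∣m+n (∣m⇒∣m*n c a≡b) (∣n⇒∣m*n b c≡d))
      where
      lemma : ∀ a b c d → (a - b) * c + b * (c - d) ≡ a * c - b * d
      lemma = solve-∀

    n≡0-mod : + n ≡ + 0 [mod n ]
    n≡0-mod = mod-by $ divides (+ 1) (trans (ℤP.+-identityʳ (+ n)) (sym (ℤP.*-identityˡ (+ n))))

    *n≡0-mod : ∀ a → a * + n ≡ + 0 [mod n ]
    *n≡0-mod a = mod-by $ divides a (trans (ℤP.+-identityʳ (a * + n)) refl)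

  ≡0-mod⇒∣ᵤ : ∀ {n a} → a ≡ + 0 [mod n ] → + n Unsigned.∣ a
  ≡0-mod⇒∣ᵤ {n} {a} (mod-by n∣a-0) = subst (+ n Unsigned.∣_) (ℤP.+-identityʳ a) (∣⇒∣ᵤ n∣a-0)

  ∣ᵤ⇒≡0-mod : ∀ {n a} → + n Unsigned.∣ a → a ≡ + 0 [mod n ]
  ∣ᵤ⇒≡0-mod {n} {a} n∣a = mod-by (∣ᵤ⇒∣ (subst (+ n Unsigned.∣_) (sym (ℤP.+-identityʳ a)) n∣a))

  residue : ∀ {n} → Fin n → ℤ
  residue i = + toℕ i

  residue-injective : ∀ {n} (i j : Fin n) → residue i ≡ residue j [mod n ] → i ≡ j
  residue-injective {n@(suc _)} i j (mod-by n∣i-j) =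
    FinP.toℕ-injective (ℤP.+-injective (ℤP.i-j≡0⇒i≡j _ _ (ℤP.∣i∣≡0⇒i≡0 d≡0)))
    where
    d = ∣ residue i - residue j ∣
    d<n : d ℕ.< n
    d<n = ℕP.≤-trans (ℕ.s≤s (subst (ℕ._≤ toℕ i ℕ.⊔ toℕ j) (cong ∣_∣ (sym (ℤP.m-n≡m⊖n (toℕ i) (toℕ j))))
                                    (ℤP.∣m⊝n∣≤m⊔n (toℕ i) (toℕ j))))
                     (ℕP.⊔-lub (FinP.toℕ<n i) (FinP.toℕ<n j))
    d≡0 : d ≡ 0
    d≡0 = trans (sym (m<n⇒m%n≡m d<n)) (n∣m⇒m%n≡0 d n (∣⇒∣ᵤ n∣i-j))

  data Inject₁View {k : ℕ} : Fin (suc k) → Set where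
    inj : (j : Fin k) → Inject₁View (inject₁ j)
    top : Inject₁View (fromℕ k)

  inject₁-view : ∀ {k} (i : Fin (suc k)) → Inject₁View i
  inject₁-view {zero} fzero = top
  inject₁-view {suc k} fzero = inj fzero
  inject₁-view {suc k} (fsuc i) with inject₁-view i
  ... | inj j = inj (fsuc j)
  ... | top = top

  inject₁-view-inject₁ : ∀ {k} (j : Fin k) → inject₁-view (inject₁ j) ≡ inj j
  inject₁-view-inject₁ {suc k} fzero = refl
  inject₁-view-inject₁ {suc k} (fsuc j) rewrite inject₁-view-inject₁ j = refl

  inject₁-view-fromℕ : ∀ k → inject₁-view (fromℕ k) ≡ top
  inject₁-view-fromℕ zero = refl
  inject₁-view-fromℕ (suc k) rewrite inject₁-view-fromℕ k = refl

  next : ∀ {k} → Fin (suc k) → Fin (suc k)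
  next i with inject₁-view i
  ... | inj j = fsuc j
  ... | top = fzero

  prev : ∀ {k} → Fin (suc k) → Fin (suc k)
  prev {k} fzero = fromℕ k
  prev (fsuc j) = inject₁ j

  next-inject₁ : ∀ {k} (j : Fin k) → next (inject₁ j) ≡ fsuc j
  next-inject₁ j rewrite inject₁-view-inject₁ j = refl

  next-fromℕ : ∀ k → next (fromℕ k) ≡ fzero
  next-fromℕ k rewrite inject₁-view-fromℕ k = refl

  next^ prev^ : ∀ {k} → ℕ → Fin (suc k) → Fin (suc k)
  next^ t i = iterate next i t
  prev^ t i = iterate prev i t

  module _ {k : ℕ} where

    private
      n = suc k

    next-residue : (i : Fin n) → residue (next i) ≡ residue i + + 1 [mod n ]
    next-residue i with inject₁-view i
    ... | inj j = ≡-mod-reflexive (cong +_ (trans (cong suc (sym (FinP.toℕ-inject₁ j))) (ℕP.+-comm 1 _)))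
    ... | top = begin
      + 0                         ≈⟨ n≡0-mod ⟨
      + (1 ℕ.+ k)                 ≡⟨ cong +_ (ℕP.+-comm 1 k) ⟩
      + (k ℕ.+ 1)                 ≡⟨ cong (λ t → + (t ℕ.+ 1)) (FinP.toℕ-fromℕ k) ⟨
      residue (fromℕ k) + + 1     ∎
      where open ≡-mod-Reasoning

    prev-residue : (i : Fin n) → residue (prev i) ≡ residue i - + 1 [mod n ]
    prev-residue fzero = begin
      residue (fromℕ k)   ≡⟨ cong +_ (FinP.toℕ-fromℕ k) ⟩
      + n - + 1           ≈⟨ +-cong-mod n≡0-mod (≡-mod-refl {a = - + 1}) ⟩
      + 0 - + 1           ∎
      where open ≡-mod-Reasoning
    prev-residue (fsuc j) = ≡-mod-reflexive (cong +_ (FinP.toℕ-inject₁ j))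

    fold-residue : (f : Fin n → Fin n) (c : ℤ) → (∀ i → residue (f i) ≡ residue i + c [mod n ]) →
                   ∀ i t → residue (fold i f t) ≡ residue i + + t * c [mod n ]
    fold-residue f c f-residue i zero =
      ≡-mod-reflexive (sym (trans (cong (_+_ (residue i)) (ℤP.*-zeroˡ c)) (ℤP.+-identityʳ _)))
    fold-residue f c f-residue i (suc t) = begin
      residue (f (fold i f t))       ≈⟨ f-residue (fold i f t) ⟩
      residue (fold i f t) + c       ≈⟨ +-cong-mod (fold-residue f c f-residue i t) ≡-mod-refl ⟩
      residue i + + t * c + c        ≡⟨ lemma (residue i) c (+ t) ⟩
      residue i + + suc t * c        ∎
      where
      open ≡-mod-Reasoning
      lemma : ∀ r c t → r + t * c + c ≡ r + (+ 1 + t) * c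
      lemma = solve-∀

    fold-cyclic : (f : Fin n → Fin n) (c : ℤ) → (∀ i → residue (f i) ≡ residue i + c [mod n ]) →
                  ∀ i → fold i f n ≡ i
    fold-cyclic f c f-residue i = residue-injective _ _ (begin
      residue (fold i f n)       ≈⟨ fold-residue f c f-residue i n ⟩
      residue i + + n * c
        ≈⟨ +-cong-mod (≡-mod-refl {a = residue i}) (subst (_≡ + 0 [mod n ]) (ℤP.*-comm c (+ n)) (*n≡0-mod c)) ⟩
      residue i + + 0            ≡⟨ ℤP.+-identityʳ (residue i) ⟩
      residue i                  ∎)
      where open ≡-mod-Reasoning

    inverse-by-residue : (f g : Fin n → Fin n) (c d : ℤ) → c + d ≡ + 0 →
                         (∀ i → residue (f i) ≡ residue i + c [mod n ]) →
                         (∀ i → residue (g i) ≡ residue i + d [mod n ]) →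
                         ∀ i → g (f i) ≡ i
    inverse-by-residue f g c d c+d≡0 f-residue g-residue i = residue-injective _ _ (begin
      residue (g (f i))          ≈⟨ g-residue (f i) ⟩
      residue (f i) + d          ≈⟨ +-cong-mod (f-residue i) ≡-mod-refl ⟩
      residue i + c + d          ≡⟨ ℤP.+-assoc (residue i) c d ⟩
      residue i + (c + d)        ≡⟨ cong (_+_ (residue i)) c+d≡0 ⟩
      residue i + + 0            ≡⟨ ℤP.+-identityʳ (residue i) ⟩
      residue i                  ∎)
      where open ≡-mod-Reasoning

    next^-residue : ∀ t (i : Fin n) → residue (next^ t i) ≡ residue i + + t [mod n ]
    next^-residue t i = begin
      residue (iterate next i t)   ≡⟨ cong residue (iterate-is-fold i next t) ⟨
      residue (fold i next t)      ≈⟨ fold-residue next (+ 1) next-residue i t ⟩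
      residue i + + t * + 1        ≡⟨ cong (_+_ (residue i)) (ℤP.*-identityʳ (+ t)) ⟩
      residue i + + t              ∎
      where open ≡-mod-Reasoning

    prev^-residue : ∀ t (i : Fin n) → residue (prev^ t i) ≡ residue i - + t [mod n ]
    prev^-residue t i = begin
      residue (iterate prev i t)   ≡⟨ cong residue (iterate-is-fold i prev t) ⟨
      residue (fold i prev t)      ≈⟨ fold-residue prev (- + 1) prev-residue i t ⟩
      residue i + + t * - + 1      ≡⟨ cong (_+_ (residue i)) (lemma (+ t)) ⟩
      residue i - + t              ∎
      where
      open ≡-mod-Reasoning
      lemma : ∀ t → t * - + 1 ≡ - t
      lemma = solve-∀

    prev-next : (i : Fin n) → prev (next i) ≡ i
    prev-next = inverse-by-residue next prev (+ 1) (- + 1) refl next-residue prev-residue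

    next-prev : (i : Fin n) → next (prev i) ≡ i
    next-prev = inverse-by-residue prev next (- + 1) (+ 1) refl prev-residue next-residue

    next^-prev^ : ∀ t (i : Fin n) → next^ t (prev^ t i) ≡ i
    next^-prev^ t = inverse-by-residue (prev^ t) (next^ t) (- + t) (+ t) (ℤP.+-inverseˡ (+ t)) (prev^-residue t) (next^-residue t)

    prev^-next^ : ∀ t (i : Fin n) → prev^ t (next^ t i) ≡ i
    prev^-next^ t = inverse-by-residue (next^ t) (prev^ t) (+ t) (- + t) (ℤP.+-inverseʳ (+ t)) (next^-residue t) (prev^-residue t)

    next^-suc-prev^ : ∀ t (i : Fin n) → next^ (suc t) (prev^ t i) ≡ next i
    next^-suc-prev^ t i = residue-injective _ _ (begin
      residue (next^ (suc t) (prev^ t i))   ≈⟨ next^-residue (suc t) (prev^ t i) ⟩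
      residue (prev^ t i) + + suc t         ≈⟨ +-cong-mod (prev^-residue t i) ≡-mod-refl ⟩
      residue i - + t + + suc t             ≡⟨ lemma (residue i) (+ t) ⟩
      residue i + + 1                       ≈⟨ next-residue i ⟨
      residue (next i)                      ∎)
      where
      open ≡-mod-Reasoning
      lemma : ∀ r t → r - t + (+ 1 + t) ≡ r + + 1
      lemma = solve-∀

module HeisenbergModulo (n : ℕ) where

  open ModularArithmetic
  open import Data.Integer using (+_; _+_; _*_)
  import Data.Integer.Properties as ℤP
  open import Data.Integer.Tactic.RingSolver using (solve-∀)

  infix 4 _≈ᴴ_
  _≈ᴴ_ : Heis → Heis → Set
  (x , y , z) ≈ᴴ (x′ , y′ , z′) = (x ≡ x′ [mod n ]) × (y ≡ y′ [mod n ]) × (z ≡ z′ [mod n ])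

  ≈ᴴ-reflexive : ∀ {g h} → g ≡ h → g ≈ᴴ h
  ≈ᴴ-reflexive refl = ≡-mod-refl , ≡-mod-refl , ≡-mod-refl

  ≈ᴴ-sym : ∀ {g h} → g ≈ᴴ h → h ≈ᴴ g
  ≈ᴴ-sym {_ , _ , _} {_ , _ , _} (p , q , r) = ≡-mod-sym p , ≡-mod-sym q , ≡-mod-sym r

  ≈ᴴ-trans : ∀ {g h k} → g ≈ᴴ h → h ≈ᴴ k → g ≈ᴴ k
  ≈ᴴ-trans {_ , _ , _} {_ , _ , _} {_ , _ , _} (p , q , r) (p′ , q′ , r′) =
    ≡-mod-trans p p′ , ≡-mod-trans q q′ , ≡-mod-trans r r′

  hmul-cong : ∀ {g g′ h h′} → g ≈ᴴ g′ → h ≈ᴴ h′ → hmul g h ≈ᴴ hmul g′ h′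
  hmul-cong {_ , _ , _} {_ , _ , _} {_ , _ , _} {_ , _ , _} (p , q , r) (p′ , q′ , r′) =
    +-cong-mod p p′ , +-cong-mod q q′ , +-cong-mod (+-cong-mod r r′) (*-cong-mod p q′)

  hmul-assoc : ∀ g h k → hmul (hmul g h) k ≡ hmul g (hmul h k)
  hmul-assoc (x , y , z) (x′ , y′ , z′) (x″ , y″ , z″) =
    cong₂ _,_ (ℤP.+-assoc x x′ x″) (cong₂ _,_ (ℤP.+-assoc y y′ y″) (lemma x y′ y″ z z′ z″ x′))
    where
    lemma : ∀ x y′ y″ z z′ z″ x′ →
            z + z′ + x * y′ + z″ + (x + x′) * y″ ≡ z + (z′ + z″ + x′ * y″) + x * (y′ + y″)
    lemma = solve-∀

  1ᴴ : Heis
  1ᴴ = + 0 , + 0 , + 0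

  hmul-identityˡ : ∀ g → hmul 1ᴴ g ≡ g
  hmul-identityˡ (x , y , z) = cong₂ _,_ (ℤP.+-identityˡ x) (cong₂ _,_ (ℤP.+-identityˡ y) (lemma y z))
    where
    lemma : ∀ y z → + 0 + z + + 0 * y ≡ z
    lemma = solve-∀

  hmul-identityʳ : ∀ g → hmul g 1ᴴ ≡ g
  hmul-identityʳ (x , y , z) = cong₂ _,_ (ℤP.+-identityʳ x) (cong₂ _,_ (ℤP.+-identityʳ y) (lemma x z))
    where
    lemma : ∀ x z → z + + 0 + x * + 0 ≡ z
    lemma = solve-∀

  InR-intro : ∀ w → hword w ≈ᴴ 1ᴴ → InR n w
  InR-intro w h with hword w | h
  ... | _ , _ , _ | p , q , r = ≡0-mod⇒∣ᵤ p , ≡0-mod⇒∣ᵤ q , ≡0-mod⇒∣ᵤ r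

  InR-elim : ∀ w → InR n w → hword w ≈ᴴ 1ᴴ
  InR-elim w r with hword w | r
  ... | _ , _ , _ | p , q , r = ∣ᵤ⇒≡0-mod p , ∣ᵤ⇒≡0-mod q , ∣ᵤ⇒≡0-mod r

module HeisenbergSchreierGraph (m : ℕ) where

  open ModularArithmetic
  open import Data.Integer using (+_; -_; _+_; _-_; _*_)
  import Data.Integer.Properties as ℤP
  open import Data.Integer.Tactic.RingSolver using (solve-∀)

  M n : ℕ
  M = suc m
  n = suc M

  -- (x , y , k) is the coset of T^k a^x b^y; as b^y a = a b^y T^-y, the letter a moves it to
  -- (x + 1 , y , k - y).
  V : Set
  V = Fin n × Fin n × Fin n

  v₀ : V
  v₀ = fzero , fzero , fzero

  T^ a^ b^ : ℕ → Word F2gen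
  T^ = pow Tc
  a^ = pow a
  b^ = pow b

  tr : V → Word F2gen
  tr (x , y , k) = T^ (toℕ k) ++ a^ (toℕ x) ++ b^ (toℕ y)

  act : V → Letter F2gen → V
  act (x , y , k) (0F , false) = next x , y , prev^ (toℕ y) k
  act (x , y , k) (0F , true) = prev x , y , next^ (toℕ y) k
  act (x , y , k) (1F , false) = x , next y , k
  act (x , y , k) (1F , true) = x , prev y , k

  act-invL : ∀ v l → act (act v l) (invL l) ≡ v
  act-invL (x , y , k) (0F , false) = cong₂ (λ x′ k′ → x′ , y , k′) (prev-next x) (next^-prev^ (toℕ y) k)
  act-invL (x , y , k) (0F , true) = cong₂ (λ x′ k′ → x′ , y , k′) (next-prev x) (prev^-next^ (toℕ y) k)
  act-invL (x , y , k) (1F , false) = cong (λ y′ → x , y′ , k) (prev-next y)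
  act-invL (x , y , k) (1F , true) = cong (λ y′ → x , y′ , k) (next-prev y)

  open SchreierRewriting act act-invL
  open HeisenbergModulo n

  -- The image of tr v in the integral Heisenberg group.
  coords : V → Heis
  coords (x , y , k) = residue x , residue y , residue k + residue x * residue y

  coords-act : ∀ v l → coords (act v l) ≈ᴴ hmul (coords v) (hletter l)
  coords-act (x , y , k) (0F , false) =
    next-residue x ,
    ≡-mod-reflexive (sym (ℤP.+-identityʳ _)) ,
    ≡-mod-trans (+-cong-mod (prev^-residue (toℕ y) k) (*-cong-mod (next-residue x) ≡-mod-refl))
                (≡-mod-reflexive (lemma (residue k) (residue x) (residue y)))
    where
    lemma : ∀ k x y → (k - y) + (x + + 1) * y ≡ (k + x * y) + + 0 + x * + 0
    lemma = solve-∀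
  coords-act (x , y , k) (0F , true) =
    prev-residue x ,
    ≡-mod-reflexive (sym (ℤP.+-identityʳ _)) ,
    ≡-mod-trans (+-cong-mod (next^-residue (toℕ y) k) (*-cong-mod (prev-residue x) ≡-mod-refl))
                (≡-mod-reflexive (lemma (residue k) (residue x) (residue y)))
    where
    lemma : ∀ k x y → (k + y) + (x - + 1) * y ≡ (k + x * y) + + 0 + x * + 0
    lemma = solve-∀
  coords-act (x , y , k) (1F , false) =
    ≡-mod-reflexive (sym (ℤP.+-identityʳ _)) ,
    next-residue y ,
    ≡-mod-trans (+-cong-mod (≡-mod-refl {a = residue k}) (*-cong-mod (≡-mod-refl {a = residue x}) (next-residue y)))
                (≡-mod-reflexive (lemma (residue k) (residue x) (residue y)))
    where
    lemma : ∀ k x y → k + x * (y + + 1) ≡ (k + x * y) + + 0 + x * + 1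
    lemma = solve-∀
  coords-act (x , y , k) (1F , true) =
    ≡-mod-reflexive (sym (ℤP.+-identityʳ _)) ,
    prev-residue y ,
    ≡-mod-trans (+-cong-mod (≡-mod-refl {a = residue k}) (*-cong-mod (≡-mod-refl {a = residue x}) (prev-residue y)))
                (≡-mod-reflexive (lemma (residue k) (residue x) (residue y)))
    where
    lemma : ∀ k x y → k + x * (y - + 1) ≡ (k + x * y) + + 0 + x * - + 1
    lemma = solve-∀

  coords-endpoint : ∀ v w → coords (endpoint v w) ≈ᴴ hmul (coords v) (hword w)
  coords-endpoint v [] = ≈ᴴ-reflexive (sym (hmul-identityʳ (coords v)))
  coords-endpoint v (l ∷ w) =
    ≈ᴴ-trans (coords-endpoint (act v l) w)
      (≈ᴴ-trans (hmul-cong (coords-act v l) (≈ᴴ-reflexive refl))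
        (≈ᴴ-reflexive (hmul-assoc (coords v) (hletter l) (hword w))))

  coords-endpoint-v₀ : ∀ w → coords (endpoint v₀ w) ≈ᴴ hword w
  coords-endpoint-v₀ w = ≈ᴴ-trans (coords-endpoint v₀ w) (≈ᴴ-reflexive (hmul-identityˡ (hword w)))

  coords≈1ᴴ⇒≡v₀ : ∀ v → coords v ≈ᴴ 1ᴴ → v ≡ v₀
  coords≈1ᴴ⇒≡v₀ (x , y , k) (p , q , r) with residue-injective x fzero p | residue-injective y fzero q
  ... | refl | refl = cong (λ k′ → fzero , fzero , k′)
                        (residue-injective k fzero (≡-mod-trans (≡-mod-reflexive (sym (ℤP.+-identityʳ (residue k)))) r))

  loop⇒InR : ∀ w → endpoint v₀ w ≡ v₀ → InR n w
  loop⇒InR w e = InR-intro w (≈ᴴ-trans (≈ᴴ-sym (coords-endpoint-v₀ w)) (≈ᴴ-reflexive (cong coords e)))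

  InR⇒loop : ∀ w → InR n w → endpoint v₀ w ≡ v₀
  InR⇒loop w r = coords≈1ᴴ⇒≡v₀ (endpoint v₀ w) (≈ᴴ-trans (coords-endpoint-v₀ w) (InR-elim w r))

  C : ℕ → ℕ → Word F2gen
  C i j = conj (a^ i ++ b^ j) Tc

  -- D (a^ x) (b^ y) = a^x b^y a b^-y a^-(x+1).  For x < n - 1 the Schreier generator of the a-edge at
  -- (x , y , k) is T^k D T^-(k-y), and D A (B b) = C⁻¹ · D A B where C = (A B) T (A B)⁻¹.
  D : Word F2gen → Word F2gen → Word F2gen
  D A B = A ++ B ++ a ++ invW B ++ invW (A ++ a)

  I : Set
  I = Idx n

  gen : I → Word I
  gen i = (i , false) ∷ []

  A₁ A₂ : Fin n → Fin n → I
  A₁ i k = inj₁ (i , k)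
  A₂ i k = inj₂ (inj₁ (i , k))

  A₃ : Fin M → Fin M → I
  A₃ i j = inj₂ (inj₂ (inj₁ (i , j)))

  A₄ : Fin M → NZPair M → I
  A₄ k ij = inj₂ (inj₂ (inj₂ (k , ij)))

  T-word : Fin M → Fin M → Fin n → Word I
  T-word i j fzero = gen (A₃ i j)
  T-word fzero fzero (fsuc k) = []
  T-word fzero (fsuc j) (fsuc k) = gen (A₄ k ((fzero , fsuc j) , _))
  T-word (fsuc i) j (fsuc k) = gen (A₄ k ((fsuc i , j) , _))

  a-word : Fin M → (j : ℕ) → .(j ℕ.≤ M) → Fin n → Word I
  a-word i zero _ k = []
  a-word i (suc j) j<M k = invW (T-word i (fromℕ< j<M) k) ++ a-word i j (ℕP.<⇒≤ j<M) (prev k)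

  row-vertex : Fin n → Fin n → ℕ → Fin n
  row-vertex y K r = fold K (prev^ (toℕ y)) r

  row-word : Fin n → Fin n → (r : ℕ) → .(r ℕ.≤ M) → Word I
  row-word y K zero _ = []
  row-word y K (suc r) r<M =
    row-word y K r (ℕP.<⇒≤ r<M) ++ a-word (fromℕ< r<M) (toℕ y) (FinP.toℕ≤pred[n] y) (row-vertex y K r)

  -- The a-edge leaving the last column closes the row a^n at height K, which is A₁.
  a-wrap-word : Fin n → Fin n → Word I
  a-wrap-word y k = invW (row-word y K M ℕP.≤-refl) ++ gen (A₁ y K)
    where K = prev^ (toℕ y) k

  a-edge : Fin n → Fin n → Fin n → Word I
  a-edge x y k with inject₁-view x
  ... | inj i = a-word i (toℕ y) (FinP.toℕ≤pred[n] y) k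
  ... | top = a-wrap-word y k

  b-edge : Fin n → Fin n → Fin n → Word I
  b-edge x y k with inject₁-view y
  ... | inj _ = []
  ... | top = gen (A₂ x k)

  γ⁺ : V → F2gen → Word I
  γ⁺ (x , y , k) 0F = a-edge x y k
  γ⁺ (x , y , k) 1F = b-edge x y k

  open FreeGroup (FinP._≟_ {2})
  open Solver (FinP._≟_ {2})

  ev : Word I → Word F2gen
  ev = eval (gens n)

  ev-invW-++ : ∀ u w → ev (invW u ++ w) ≡ invW (ev u) ++ ev w
  ev-invW-++ u w = trans (eval-++ (gens n) (invW u) w) (cong (_++ ev w) (eval-invW (gens n) u))

  T-word-eval : ∀ i j k → ev (T-word i j k) ~ T^ (toℕ (prev k)) ++ C (toℕ i) (toℕ j) ++ invW (T^ (toℕ k))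
  T-word-eval i j fzero = ~-reflexive (trans (List.++-assoc (T^ M) (C (toℕ i) (toℕ j)) [])
                                              (cong (λ t → T^ t ++ C (toℕ i) (toℕ j) ++ []) (sym (FinP.toℕ-fromℕ M))))
  T-word-eval fzero fzero (fsuc k) rewrite FinP.toℕ-inject₁ k = begin
    []                                   ≈⟨ solve 2 (λ P T → ε ⊜ P ∙ (T ∙ ε) ∙ (P ∙ T) ⁻¹) ~-refl P Tc ⟩
    P ++ (Tc ++ []) ++ invW (P ++ Tc)     ≡⟨ cong (λ w → P ++ (Tc ++ []) ++ invW w) (pow-sucʳ Tc (toℕ k)) ⟨
    P ++ (Tc ++ []) ++ invW (T^ (suc (toℕ k)))  ∎
    where
    open ~-Reasoning
    P = T^ (toℕ k)
  T-word-eval fzero (fsuc j) (fsuc k) rewrite FinP.toℕ-inject₁ k = ~-reflexive (List.++-identityʳ _)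
  T-word-eval (fsuc i) j (fsuc k) rewrite FinP.toℕ-inject₁ k = ~-reflexive (List.++-identityʳ _)

  a-word-eval : ∀ i j .(j≤M : j ℕ.≤ M) k →
                ev (a-word i j j≤M k) ~ T^ (toℕ k) ++ D (a^ (toℕ i)) (b^ j) ++ invW (T^ (toℕ (prev^ j k)))
  a-word-eval i zero _ k =
    solve 3 (λ P A x → ε ⊜ P ∙ (A ∙ ε ∙ x ∙ ε ⁻¹ ∙ (A ∙ x) ⁻¹) ∙ P ⁻¹) ~-refl (T^ (toℕ k)) (a^ (toℕ i)) a
  a-word-eval i (suc j) j<M k = begin
    ev (invW (T-word i (fromℕ< j<M) k) ++ a-word i j _ (prev k))
      ≡⟨ ev-invW-++ (T-word i (fromℕ< j<M) k) (a-word i j _ (prev k)) ⟩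
    invW (ev (T-word i (fromℕ< j<M) k)) ++ ev (a-word i j _ (prev k))
      ≈⟨ ++-cong (invW-cong (T-word-eval i (fromℕ< j<M) k)) (a-word-eval i j _ (prev k)) ⟩
    invW (P ++ C (toℕ i) (toℕ (fromℕ< j<M)) ++ invW Q) ++ P ++ D A (b^ j) ++ invW R
      ≡⟨ cong (λ j′ → invW (P ++ C (toℕ i) j′ ++ invW Q) ++ P ++ D A (b^ j) ++ invW R) (FinP.toℕ-fromℕ< j<M) ⟩
    invW (P ++ C (toℕ i) j ++ invW Q) ++ P ++ D A (b^ j) ++ invW R
      ≈⟨ solve 7 (λ P Q R A B x y →
                    (P ∙ ((A ∙ B) ∙ (x ∙ y ∙ x ⁻¹ ∙ y ⁻¹) ∙ (A ∙ B) ⁻¹) ∙ Q ⁻¹) ⁻¹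
                      ∙ P ∙ (A ∙ B ∙ x ∙ B ⁻¹ ∙ (A ∙ x) ⁻¹) ∙ R ⁻¹
                    ⊜ Q ∙ (A ∙ (B ∙ y) ∙ x ∙ (B ∙ y) ⁻¹ ∙ (A ∙ x) ⁻¹) ∙ R ⁻¹)
                 ~-refl P Q R A (b^ j) a b ⟩
    Q ++ D A (b^ j ++ b) ++ invW R
      ≡⟨ cong (λ B → Q ++ D A B ++ invW R) (pow-sucʳ b j) ⟨
    Q ++ D A (b^ (suc j)) ++ invW R ∎
    where
    open ~-Reasoning
    A = a^ (toℕ i)
    P = T^ (toℕ (prev k))
    Q = T^ (toℕ k)
    R = T^ (toℕ (prev^ j (prev k)))

  row-word-eval : ∀ y K r .(r≤M : r ℕ.≤ M) →
                  ev (row-word y K r r≤M) ~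
                  T^ (toℕ K) ++ b^ (toℕ y) ++ a^ r ++ invW (T^ (toℕ (row-vertex y K r)) ++ a^ r ++ b^ (toℕ y))
  row-word-eval y K zero _ = solve 2 (λ P B → ε ⊜ P ∙ B ∙ ε ∙ (P ∙ ε ∙ B) ⁻¹) ~-refl (T^ (toℕ K)) (b^ (toℕ y))
  row-word-eval y K (suc r) r<M = begin
    ev (row-word y K r _ ++ a-word (fromℕ< r<M) (toℕ y) _ Kᵣ)
      ≡⟨ eval-++ (gens n) (row-word y K r _) (a-word (fromℕ< r<M) (toℕ y) _ Kᵣ) ⟩
    ev (row-word y K r _) ++ ev (a-word (fromℕ< r<M) (toℕ y) _ Kᵣ)
      ≈⟨ ++-cong (row-word-eval y K r _) (a-word-eval (fromℕ< r<M) (toℕ y) _ Kᵣ) ⟩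
    (P ++ B ++ a^ r ++ invW (Q ++ a^ r ++ B)) ++ Q ++ D (a^ (toℕ (fromℕ< r<M))) B ++ invW R
      ≡⟨ cong (λ r′ → (P ++ B ++ a^ r ++ invW (Q ++ a^ r ++ B)) ++ Q ++ D (a^ r′) B ++ invW R) (FinP.toℕ-fromℕ< r<M) ⟩
    (P ++ B ++ a^ r ++ invW (Q ++ a^ r ++ B)) ++ Q ++ D (a^ r) B ++ invW R
      ≈⟨ solve 6 (λ P Q R A B x → (P ∙ B ∙ A ∙ (Q ∙ A ∙ B) ⁻¹) ∙ Q ∙ (A ∙ B ∙ x ∙ B ⁻¹ ∙ (A ∙ x) ⁻¹) ∙ R ⁻¹
                                  ⊜ P ∙ B ∙ (A ∙ x) ∙ (R ∙ (A ∙ x) ∙ B) ⁻¹)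
                 ~-refl P Q R (a^ r) B a ⟩
    P ++ B ++ (a^ r ++ a) ++ invW (R ++ (a^ r ++ a) ++ B)
      ≡⟨ cong (λ A → P ++ B ++ A ++ invW (R ++ A ++ B)) (pow-sucʳ a r) ⟨
    P ++ B ++ a^ (suc r) ++ invW (R ++ a^ (suc r) ++ B) ∎
    where
    open ~-Reasoning
    Kᵣ = row-vertex y K r
    B = b^ (toℕ y)
    P = T^ (toℕ K)
    Q = T^ (toℕ Kᵣ)
    R = T^ (toℕ (row-vertex y K (suc r)))

  row-vertex-wrap : ∀ y k → row-vertex y (prev^ (toℕ y) k) M ≡ k
  row-vertex-wrap y k = begin
    fold (prev^ (toℕ y) k) (prev^ (toℕ y)) M   ≡⟨ fold-+ k (prev^ (toℕ y)) M ⟨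
    fold k (prev^ (toℕ y)) (M ℕ.+ 1)          ≡⟨ cong (fold k (prev^ (toℕ y))) (ℕP.+-comm M 1) ⟩
    fold k (prev^ (toℕ y)) n                  ≡⟨ fold-cyclic (prev^ (toℕ y)) (- + toℕ y) (prev^-residue (toℕ y)) k ⟩
    k                                         ∎
    where open ≡-Reasoning

  inner-a-edge-eval : ∀ i y k → ev (a-word i (toℕ y) (FinP.toℕ≤pred[n] y) k) ~
                                tr (inject₁ i , y , k) ++ a ++ invW (tr (fsuc i , y , prev^ (toℕ y) k))
  inner-a-edge-eval i y k = begin
    ev (a-word i (toℕ y) _ k)                   ≈⟨ a-word-eval i (toℕ y) _ k ⟩
    P ++ D A B ++ invW Q                        ≈⟨ solve 5 (λ P Q A B x → P ∙ (A ∙ B ∙ x ∙ B ⁻¹ ∙ (A ∙ x) ⁻¹) ∙ Q ⁻¹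
                                                                      ⊜ (P ∙ A ∙ B) ∙ x ∙ (Q ∙ (A ∙ x) ∙ B) ⁻¹)
                                                         ~-refl P Q A B a ⟩
    (P ++ A ++ B) ++ a ++ invW (Q ++ (A ++ a) ++ B)
      ≡⟨ cong₂ (λ A′ A″ → (P ++ A′ ++ B) ++ a ++ invW (Q ++ A″ ++ B))
               (cong a^ (sym (FinP.toℕ-inject₁ i))) (sym (pow-sucʳ a (toℕ i))) ⟩
    tr (inject₁ i , y , k) ++ a ++ invW (tr (fsuc i , y , prev^ (toℕ y) k)) ∎
    where
    open ~-Reasoning
    A = a^ (toℕ i)
    B = b^ (toℕ y)
    P = T^ (toℕ k)
    Q = T^ (toℕ (prev^ (toℕ y) k))

  last-a-edge-eval : ∀ y k → ev (a-wrap-word y k) ~ tr (fromℕ M , y , k) ++ a ++ invW (tr (fzero , y , prev^ (toℕ y) k))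
  last-a-edge-eval y k = begin
    ev (invW (row-word y K M _) ++ gen (A₁ y K))
      ≡⟨ ev-invW-++ (row-word y K M _) (gen (A₁ y K)) ⟩
    invW (ev (row-word y K M _)) ++ ev (gen (A₁ y K))
      ≈⟨ ++-congˡ (ev (gen (A₁ y K))) (invW-cong (row-word-eval y K M _)) ⟩
    invW (P ++ B ++ a^ M ++ invW (T^ (toℕ (row-vertex y K M)) ++ a^ M ++ B)) ++ conj P (conj B (a^ n)) ++ []
      ≡⟨ cong₂ (λ k′ A → invW (P ++ B ++ a^ M ++ invW (T^ (toℕ k′) ++ a^ M ++ B)) ++ conj P (conj B A) ++ [])
               (row-vertex-wrap y k) (pow-sucʳ a M) ⟩
    invW (P ++ B ++ a^ M ++ invW (Q ++ a^ M ++ B)) ++ conj P (conj B (a^ M ++ a)) ++ []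
      ≈⟨ solve 5 (λ P Q A B x → (P ∙ B ∙ A ∙ (Q ∙ A ∙ B) ⁻¹) ⁻¹ ∙ (P ∙ (B ∙ (A ∙ x) ∙ B ⁻¹) ∙ P ⁻¹) ∙ ε
                                ⊜ (Q ∙ A ∙ B) ∙ x ∙ (P ∙ ε ∙ B) ⁻¹)
                 ~-refl P Q (a^ M) B a ⟩
    (Q ++ a^ M ++ B) ++ a ++ invW (P ++ [] ++ B)
      ≡⟨ cong (λ t → (Q ++ a^ t ++ B) ++ a ++ invW (P ++ [] ++ B)) (sym (FinP.toℕ-fromℕ M)) ⟩
    tr (fromℕ M , y , k) ++ a ++ invW (tr (fzero , y , K)) ∎
    where
    open ~-Reasoning
    K = prev^ (toℕ y) k
    B = b^ (toℕ y)
    P = T^ (toℕ K)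
    Q = T^ (toℕ k)

  inner-b-edge-eval : ∀ x j k → [] ~ tr (x , inject₁ j , k) ++ b ++ invW (tr (x , fsuc j , k))
  inner-b-edge-eval x j k = begin
    []                                                  ≈⟨ solve 4 (λ P A B y → ε ⊜ (P ∙ A ∙ B) ∙ y ∙ (P ∙ A ∙ (B ∙ y)) ⁻¹)
                                                                   ~-refl P A (b^ (toℕ j)) b ⟩
    (P ++ A ++ b^ (toℕ j)) ++ b ++ invW (P ++ A ++ (b^ (toℕ j) ++ b))
      ≡⟨ cong₂ (λ B B′ → (P ++ A ++ B) ++ b ++ invW (P ++ A ++ B′))
               (cong b^ (sym (FinP.toℕ-inject₁ j))) (sym (pow-sucʳ b (toℕ j))) ⟩
    tr (x , inject₁ j , k) ++ b ++ invW (tr (x , fsuc j , k)) ∎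
    where
    open ~-Reasoning
    A = a^ (toℕ x)
    P = T^ (toℕ k)

  last-b-edge-eval : ∀ x k → ev (gen (A₂ x k)) ~ tr (x , fromℕ M , k) ++ b ++ invW (tr (x , fzero , k))
  last-b-edge-eval x k = begin
    conj P (conj A (b^ n)) ++ []             ≡⟨ cong (λ B → conj P (conj A B) ++ []) (pow-sucʳ b M) ⟩
    conj P (conj A (b^ M ++ b)) ++ []
      ≈⟨ solve 4 (λ P A B y → (P ∙ (A ∙ (B ∙ y) ∙ A ⁻¹) ∙ P ⁻¹) ∙ ε ⊜ (P ∙ A ∙ B) ∙ y ∙ (P ∙ A ∙ ε) ⁻¹)
                 ~-refl P A (b^ M) b ⟩
    (P ++ A ++ b^ M) ++ b ++ invW (P ++ A ++ [])
      ≡⟨ cong (λ t → (P ++ A ++ b^ t) ++ b ++ invW (P ++ A ++ [])) (sym (FinP.toℕ-fromℕ M)) ⟩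
    tr (x , fromℕ M , k) ++ b ++ invW (tr (x , fzero , k)) ∎
    where
    open ~-Reasoning
    A = a^ (toℕ x)
    P = T^ (toℕ k)

  γ⁺-eval : ∀ v x → ev (γ⁺ v x) ~ tr v ++ (x , false) ∷ invW (tr (act v (x , false)))
  γ⁺-eval (x , y , k) 0F with inject₁-view x
  ... | inj i = inner-a-edge-eval i y k
  ... | top = last-a-edge-eval y k
  γ⁺-eval (x , y , k) 1F with inject₁-view y
  ... | inj j = inner-b-edge-eval x j k
  ... | top = last-b-edge-eval x k

  open Rewriting (FinP._≟_ {2}) (_≟Idx_ {n}) γ⁺
  private
    module FI = FreeGroup (_≟Idx_ {n})
    module SI = Solver (_≟Idx_ {n})

  a-edge-inject₁ : ∀ i y k → a-edge (inject₁ i) y k ≡ a-word i (toℕ y) (FinP.toℕ≤pred[n] y) k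
  a-edge-inject₁ i y k rewrite inject₁-view-inject₁ i = refl

  a-edge-fromℕ : ∀ y k → a-edge (fromℕ M) y k ≡ a-wrap-word y k
  a-edge-fromℕ y k rewrite inject₁-view-fromℕ M = refl

  b-edge-inject₁ : ∀ x j k → b-edge x (inject₁ j) k ≡ []
  b-edge-inject₁ x j k rewrite inject₁-view-inject₁ j = refl

  b-edge-fromℕ : ∀ x k → b-edge x (fromℕ M) k ≡ gen (A₂ x k)
  b-edge-fromℕ x k rewrite inject₁-view-fromℕ M = refl

  a-word-cong : ∀ i {j j′} .{p : j ℕ.≤ M} .{q : j′ ℕ.≤ M} k → j ≡ j′ → a-word i j p k ≡ a-word i j′ q k
  a-word-cong i k refl = refl

  a-step-bottom : ∀ K i → Rewrites (inject₁ i , fzero , K) a [] (fsuc i , fzero , K)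
  a-step-bottom K i = Rewrites-step (a-edge-inject₁ i fzero K) (cong (λ x → x , fzero , K) (next-inject₁ i))

  b-step : ∀ x K j → Rewrites (x , inject₁ j , K) b [] (x , fsuc j , K)
  b-step x K j = Rewrites-step (b-edge-inject₁ x j K) (cong (λ y → x , y , K) (next-inject₁ j))

  -- Around the square a b a⁻¹ b⁻¹ only the two a-edges contribute, and by the recursion of a-word
  -- they differ by exactly one T-word.
  T-loop : ∀ i j K → Rewrites (inject₁ i , inject₁ j , K) Tc (T-word i j (next K)) (inject₁ i , inject₁ j , next K)
  T-loop i j K =
    Rewrites-resp-~ loop-word (Rewrites-++ a-step (Rewrites-++ (b-step (fsuc i) K′ j) (Rewrites-++ a⁻¹-step b⁻¹-step)))
    where
    K′ = prev^ (toℕ j) K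
    a-step : Rewrites (inject₁ i , inject₁ j , K) a (a-word i (toℕ j) _ K) (fsuc i , inject₁ j , K′)
    a-step = Rewrites-step (trans (a-edge-inject₁ i (inject₁ j) K) (a-word-cong i K (FinP.toℕ-inject₁ j)))
                           (cong₂ (λ x t → x , inject₁ j , prev^ t K) (next-inject₁ i) (FinP.toℕ-inject₁ j))
    a⁻¹-step : Rewrites (fsuc i , fsuc j , K′) (invW a) (invW (a-word i (suc (toℕ j)) _ (next K)))
                        (inject₁ i , fsuc j , next K)
    a⁻¹-step = Rewrites-step (cong invW (trans (cong (a-edge (inject₁ i) (fsuc j)) (next^-suc-prev^ (toℕ j) K))
                                                (a-edge-inject₁ i (fsuc j) (next K))))
                             (cong (λ k → inject₁ i , fsuc j , k) (next^-suc-prev^ (toℕ j) K))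
    b⁻¹-step : Rewrites (inject₁ i , fsuc j , next K) (invW b) [] (inject₁ i , inject₁ j , next K)
    b⁻¹-step = Rewrites-step (cong invW (b-edge-inject₁ (inject₁ i) j (next K))) refl
    loop-word : a-word i (toℕ j) _ K ++ [] ++ invW (a-word i (suc (toℕ j)) (FinP.toℕ<n j) (next K)) ++ []
                FI.~ T-word i j (next K)
    loop-word = begin
      G ++ [] ++ invW (invW (T-word i (fromℕ< (FinP.toℕ<n j)) (next K)) ++ a-word i (toℕ j) _ (prev (next K))) ++ []
        ≡⟨ cong₂ (λ j′ k′ → G ++ [] ++ invW (invW (T-word i j′ (next K)) ++ a-word i (toℕ j) j≤M k′) ++ [])
                 (FinP.fromℕ<-toℕ j (FinP.toℕ<n j)) (prev-next K) ⟩
      G ++ [] ++ invW (invW (T-word i j (next K)) ++ G) ++ []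
        ≈⟨ SI.solve 2 (λ G L → G ∙ ε ∙ (L ⁻¹ ∙ G) ⁻¹ ∙ ε ⊜ L) FI.~-refl G (T-word i j (next K)) ⟩
      T-word i j (next K) ∎
      where
      open FI.~-Reasoning
      j≤M = ℕP.<⇒≤ (FinP.toℕ<n j)
      G = a-word i (toℕ j) j≤M K

  T-power : ∀ k → Rewrites v₀ (T^ (toℕ k)) [] (fzero , fzero , k)
  T-power = power-walk Tc (λ k → fzero , fzero , k) λ k →
    subst (λ k′ → Rewrites (fzero , fzero , inject₁ k) Tc (T-word fzero fzero k′) (fzero , fzero , k′))
          (next-inject₁ k) (T-loop fzero fzero (inject₁ k))

  a-power : ∀ K x → Rewrites (fzero , fzero , K) (a^ (toℕ x)) [] (x , fzero , K)
  a-power K = power-walk a (λ x → x , fzero , K) (a-step-bottom K)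

  b-power : ∀ x K y → Rewrites (x , fzero , K) (b^ (toℕ y)) [] (x , y , K)
  b-power x K = power-walk b (λ y → x , y , K) (b-step x K)

  ab-walk : ∀ i j K → Rewrites (fzero , fzero , K) (a^ (toℕ i) ++ b^ (toℕ j)) [] (inject₁ i , inject₁ j , K)
  ab-walk i j K = subst (λ w → Rewrites (fzero , fzero , K) w [] (inject₁ i , inject₁ j , K))
                        (cong₂ (λ s t → a^ s ++ b^ t) (FinP.toℕ-inject₁ i) (FinP.toℕ-inject₁ j))
                        (Rewrites-++ (a-power K (inject₁ i)) (b-power (inject₁ i) K (inject₁ j)))

  row-walk : ∀ y K r .(r≤M : r ℕ.≤ M) (x : Fin n) → toℕ x ≡ r →
             Rewrites (fzero , y , K) (a^ r) (row-word y K r r≤M) (x , y , row-vertex y K r)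
  row-walk y K zero _ fzero _ = Rewrites-[] (fzero , y , K)
  row-walk y K (suc r) r<M (fsuc x) x≡1+r =
    subst (λ w → Rewrites (fzero , y , K) w (row-word y K (suc r) r<M) (fsuc x , y , row-vertex y K (suc r))) (sym (pow-sucʳ a r))
      (Rewrites-++ (row-walk y K r (ℕP.<⇒≤ r<M) (inject₁ x) (trans (FinP.toℕ-inject₁ x) (ℕP.suc-injective x≡1+r)))
                   (Rewrites-step (trans (a-edge-inject₁ x y Kᵣ)
                                         (cong (λ x′ → a-word x′ (toℕ y) (FinP.toℕ≤pred[n] y) Kᵣ) x≡r))
                                  (cong (λ x′ → x′ , y , prev^ (toℕ y) Kᵣ) (next-inject₁ x))))
    where
    Kᵣ = row-vertex y K r
    x≡r : x ≡ fromℕ< r<M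
    x≡r = FinP.toℕ-injective (trans (ℕP.suc-injective x≡1+r) (sym (FinP.toℕ-fromℕ< r<M)))

  A₁-rewrite : ∀ i k → Rewrites v₀ (gens n (A₁ i k)) (gen (A₁ i k)) v₀
  A₁-rewrite i k = Rewrites-conj (T-power k) (Rewrites-conj (b-power fzero k i) full-row)
    where
    Kₘ = row-vertex i k M
    cyclic : prev^ (toℕ i) Kₘ ≡ k
    cyclic = fold-cyclic (prev^ (toℕ i)) (- + toℕ i) (prev^-residue (toℕ i)) k
    wrap : Rewrites (fromℕ M , i , Kₘ) a (invW (row-word i k M ℕP.≤-refl) ++ gen (A₁ i k)) (fzero , i , k)
    wrap = Rewrites-step (trans (a-edge-fromℕ i Kₘ) (cong (λ K → invW (row-word i K M ℕP.≤-refl) ++ gen (A₁ i K)) cyclic))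
                         (cong₂ (λ x K → x , i , K) (next-fromℕ M) cyclic)
    full-row : Rewrites (fzero , i , k) (a^ n) (gen (A₁ i k)) (fzero , i , k)
    full-row = subst (λ w → Rewrites (fzero , i , k) w (gen (A₁ i k)) (fzero , i , k)) (sym (pow-sucʳ a M))
      (Rewrites-resp-~ (FI.cancel-inverseʳ (row-word i k M ℕP.≤-refl) (gen (A₁ i k)))
        (Rewrites-++ (row-walk i k M ℕP.≤-refl (fromℕ M) (FinP.toℕ-fromℕ M)) wrap))

  A₂-rewrite : ∀ i k → Rewrites v₀ (gens n (A₂ i k)) (gen (A₂ i k)) v₀
  A₂-rewrite i k = Rewrites-conj (T-power k) (Rewrites-conj (a-power k i) full-column)
    where
    column : Rewrites (i , fzero , k) (b^ M) [] (i , fromℕ M , k)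
    column = subst (λ t → Rewrites (i , fzero , k) (b^ t) [] (i , fromℕ M , k)) (FinP.toℕ-fromℕ M) (b-power i k (fromℕ M))
    full-column : Rewrites (i , fzero , k) (b^ n) (gen (A₂ i k)) (i , fzero , k)
    full-column = subst (λ w → Rewrites (i , fzero , k) w (gen (A₂ i k)) (i , fzero , k)) (sym (pow-sucʳ b M))
      (Rewrites-++ column (Rewrites-step (b-edge-fromℕ i k) (cong (λ y → i , y , k) (next-fromℕ M))))

  A₃-rewrite : ∀ i j → Rewrites v₀ (gens n (A₃ i j)) (gen (A₃ i j)) v₀
  A₃-rewrite i j =
    Rewrites-++ (subst (λ t → Rewrites v₀ (T^ t) [] (fzero , fzero , fromℕ M)) (FinP.toℕ-fromℕ M) (T-power (fromℕ M)))
      (Rewrites-++ (ab-walk i j (fromℕ M)) (Rewrites-++ loop (Rewrites-invW (ab-walk i j fzero))))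
    where
    loop : Rewrites (inject₁ i , inject₁ j , fromℕ M) Tc (gen (A₃ i j)) (inject₁ i , inject₁ j , fzero)
    loop = subst (λ k → Rewrites (inject₁ i , inject₁ j , fromℕ M) Tc (T-word i j k) (inject₁ i , inject₁ j , k))
                 (next-fromℕ M) (T-loop i j (fromℕ M))

  T-word-A₄ : ∀ k i j p → T-word i j (fsuc k) ≡ gen (A₄ k ((i , j) , p))
  T-word-A₄ k fzero fzero ()
  T-word-A₄ k fzero (fsuc j) p = refl
  T-word-A₄ k (fsuc i) j p = refl

  A₄-rewrite : ∀ k i j p → Rewrites v₀ (gens n (A₄ k ((i , j) , p))) (gen (A₄ k ((i , j) , p))) v₀
  A₄-rewrite k i j p =
    Rewrites-++ (subst (λ t → Rewrites v₀ (T^ t) [] (fzero , fzero , inject₁ k)) (FinP.toℕ-inject₁ k) (T-power (inject₁ k)))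
      (Rewrites-++ (Rewrites-++ (ab-walk i j (inject₁ k)) (Rewrites-++ loop (Rewrites-invW (ab-walk i j (fsuc k)))))
                   (Rewrites-invW (T-power (fsuc k))))
    where
    loop : Rewrites (inject₁ i , inject₁ j , inject₁ k) Tc (gen (A₄ k ((i , j) , p))) (inject₁ i , inject₁ j , fsuc k)
    loop = subst₂ (λ w k′ → Rewrites (inject₁ i , inject₁ j , inject₁ k) Tc w (inject₁ i , inject₁ j , k′))
                  (trans (cong (T-word i j) (next-inject₁ k)) (T-word-A₄ k i j p)) (next-inject₁ k)
                  (T-loop i j (inject₁ k))

  gens-rewrite : ∀ i → Rewrites v₀ (gens n i) (gen i) v₀
  gens-rewrite (inj₁ (i , k)) = A₁-rewrite i k
  gens-rewrite (inj₂ (inj₁ (i , k))) = A₂-rewrite i k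
  gens-rewrite (inj₂ (inj₂ (inj₁ (i , j)))) = A₃-rewrite i j
  gens-rewrite (inj₂ (inj₂ (inj₂ (k , ((i , j) , p))))) = A₄-rewrite k i j p

  is-free-basis : IsFreeBasisOfR n (reduceIdx {n}) (gens n)
  is-free-basis = in-R , onto-R , one-to-one
    where
    in-R : ∀ w → InR n (ev w)
    in-R w = loop⇒InR (ev w) (endpoint≡ (eval-rewrites (gens n) v₀ gens-rewrite w))
    onto-R : ∀ x → InR n x → Σ (Word I) λ w → reduce₂ (ev w) ≡ reduce₂ x
    onto-R x x∈R = τ v₀ x , reduce-≡ (begin
      ev (τ v₀ x)                             ≈⟨ τ-eval (gens n) tr γ⁺-eval v₀ x ⟩
      x ++ invW (tr (endpoint v₀ x))          ≡⟨ cong (λ v → x ++ invW (tr v)) (InR⇒loop x x∈R) ⟩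
      x ++ []                                 ≡⟨ List.++-identityʳ x ⟩
      x                                       ∎)
      where open ~-Reasoning
    one-to-one : ∀ u u′ → reduce₂ (ev u) ≡ reduce₂ (ev u′) → reduceIdx u ≡ reduceIdx u′
    one-to-one u u′ e = FI.reduce-≡ (eval-injective (gens n) v₀ gens-rewrite u u′ (mk~ e))

module Counting where

  open import Data.Nat using (_+_; _*_)
  open import Data.Sum using (_⊎_)
  open import Data.Unit using (tt)
  open import Function.Bundles using (mk↔ₛ′)
  open import Data.Nat.Tactic.RingSolver using (solve-∀)
  open import Data.Product.Function.NonDependent.Propositional using (_×-↔_)
  open import Data.Sum.Function.Propositional using (_⊎-↔_)
  open import Function.Properties.Inverse using (↔-refl; ↔-sym; ↔-trans)

  NZPair↔ : ∀ m → NZPair (suc m) ↔ (Fin m ⊎ Fin m × Fin (suc m))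
  NZPair↔ m = mk↔ₛ′ to from to-from from-to
    where
    to : NZPair (suc m) → Fin m ⊎ Fin m × Fin (suc m)
    to ((fzero , fzero) , ())
    to ((fzero , fsuc j) , _) = inj₁ j
    to ((fsuc i , j) , _) = inj₂ (i , j)
    from : Fin m ⊎ Fin m × Fin (suc m) → NZPair (suc m)
    from (inj₁ j) = (fzero , fsuc j) , tt
    from (inj₂ (i , j)) = (fsuc i , j) , tt
    to-from : ∀ x → to (from x) ≡ x
    to-from (inj₁ j) = refl
    to-from (inj₂ _) = refl
    from-to : ∀ x → from (to x) ≡ x
    from-to ((fzero , fzero) , ())
    from-to ((fzero , fsuc j) , _) = refl
    from-to ((fsuc i , j) , _) = refl

  infixr 2 _⊎ᶠ_
  infixr 3 _×ᶠ_

  _⊎ᶠ_ : ∀ {A B : Set} {a b} → A ↔ Fin a → B ↔ Fin b → (A ⊎ B) ↔ Fin (a + b)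
  A↔ ⊎ᶠ B↔ = ↔-trans (A↔ ⊎-↔ B↔) (↔-sym FinP.+↔⊎)

  _×ᶠ_ : ∀ {A B : Set} {a b} → A ↔ Fin a → B ↔ Fin b → (A × B) ↔ Fin (a * b)
  A↔ ×ᶠ B↔ = ↔-trans (A↔ ×-↔ B↔) (↔-sym FinP.*↔×)

  Idx↔Fin : ∀ m → Idx (2 + m) ↔ Fin (suc ((2 + m) ^ 3))
  Idx↔Fin m = subst (λ c → Idx (2 + m) ↔ Fin c) (card m)
    (↔-refl ×ᶠ ↔-refl ⊎ᶠ ↔-refl ×ᶠ ↔-refl ⊎ᶠ ↔-refl ×ᶠ ↔-refl ⊎ᶠ
     ↔-refl ×ᶠ ↔-trans (NZPair↔ m) (↔-refl ⊎ᶠ ↔-refl ×ᶠ ↔-refl))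
    where
    -- (2 + m) ^ 3 is written out as a product, which the ring solver accepts.
    card : ∀ m → (2 + m) * (2 + m) + ((2 + m) * (2 + m) + ((1 + m) * (1 + m) + (1 + m) * (m + m * (1 + m))))
                 ≡ 1 + (2 + m) * ((2 + m) * ((2 + m) * 1))
    card = solve-∀

lemma2p10 : (n : ℕ) → 2 ≤ n →
    IsFreeBasisOfR n (reduceIdx {n}) (gens n) × (Idx n ↔ Fin (suc (n ^ 3)))
lemma2p10 (suc (suc m)) _ = HeisenbergSchreierGraph.is-free-basis m , Counting.Idx↔Fin m
lemma2p10 1 (ℕ.s≤s ())
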